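{- Let $j,k$ be integers with $k+250<j<3k/2$, $j\ge 212299$ and $k\ge 141534$. Let $G$ be a complete graph on $4j+1$ vertices whose edges are colored red and blue such that the red subgraph contains no cycle $C_{2k+1}$ and the blue subgraph contains no wheel $W_{2j}$. Let $v$ be a vertex of $G$ of maximum blue degree and let $H$ be the subgraph induced on the blue neighborhood $N^B(v)$. Let $a,b$ be vertices of $H$ joined by a red edge, each having fewer than $j$ blue neighbors in $H$. Let $C$ be a red cycle of length $2j-502$ in $H-a-b$, with vertices labeled by $\mathbb{Z}/(2j-502)\mathbb{Z}$ so that $i$ and $i+1$ are consecutive on $C$. Suppose there is a vertex $c$ of $H$, not on $C$ and distinct from $a,b$, such that the edges $ac$ and $bc$ are red. For each label $i$ set $A_i=1$ if the edge $ai$ is red and $A_i=0$ if blue, and $B_i=1$ if $bi$ is red and $B_i=0$ if blue. Then $|\{x: A_x\neq A_{x+1}\}|\le 1000$ and $|\{x: B_x\neq B_{x+1}\}|\le 1000$.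
   Context: $C_m$ is the cycle of length $m$; the wheel $W_{n}$ consists of a cycle $C_n$ together with a hub vertex adjacent to all cycle vertices. Indices of labels are taken modulo $2j-502$. -}

module Defs where

open import Data.Nat using (ℕ; zero; suc; _+_)
open import Data.Nat.DivMod using (_%_; m%n<n)
import Data.Bool
open import Data.Bool using (Bool; true; false; not; _∧_; if_then_else_)
import Data.Fin
open import Data.Fin using (Fin; toℕ; fromℕ<; _≟_)
open import Data.Product using (Σ; _×_)
open import Relation.Binary.PropositionalEquality using (_≡_; _≢_)
open import Relation.Nullary.Decidable using (⌊_⌋)
open import Function.Definitions using (Injective)

-- A 2-colouring of the edges of the complete graph on Fin n:
-- col u v = true means the edge uv is red, false means blue.
-- (Values on the diagonal u = v are irrelevant and never used.)
Colour : Set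
Colour = Bool

red blue : Colour
red = true
blue = false

Colouring : ℕ → Set
Colouring n = Fin n → Fin n → Colour

SymmetricColouring : ∀ {n} → Colouring n → Set
SymmetricColouring {n} col = (u v : Fin n) → col u v ≡ col v u

next : ∀ {m} → Fin m → Fin m
next {suc m} i = fromℕ< (m%n<n (suc (toℕ i)) (suc m))

count : ∀ {n} → (Fin n → Bool) → ℕ
count {zero} p = 0
count {suc n} p = (if p Fin.zero then 1 else 0) + count (λ i → p (Fin.suc i))

_≠ᵇ_ : ∀ {n} → Fin n → Fin n → Bool
u ≠ᵇ v = not ⌊ u ≟ v ⌋

MonoCycle : ∀ {n} → Colouring n → Colour → (m : ℕ) → (Fin m → Fin n) → Set
MonoCycle col c m f =
  Injective _≡_ _≡_ f × ((i : Fin m) → col (f i) (f (next i)) ≡ c)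

HasMonoCycle : ∀ {n} → Colouring n → Colour → ℕ → Set
HasMonoCycle {n} col c m = Σ (Fin m → Fin n) λ f → MonoCycle col c m f

HasMonoWheel : ∀ {n} → Colouring n → Colour → ℕ → Set
HasMonoWheel {n} col c m =
  Σ (Fin n) λ h → Σ (Fin m → Fin n) λ f →
    MonoCycle col c m f × ((i : Fin m) → f i ≢ h) × ((i : Fin m) → col h (f i) ≡ c)

blueDeg : ∀ {n} → Colouring n → Fin n → ℕ
blueDeg col v = count (λ u → (u ≠ᵇ v) ∧ not (col v u))

inNB : ∀ {n} → Colouring n → Fin n → Fin n → Bool
inNB col v u = (u ≠ᵇ v) ∧ not (col v u)

blueDegInH : ∀ {n} → Colouring n → Fin n → Fin n → ℕ
blueDegInH col v a = count (λ u → inNB col v u ∧ (u ≠ᵇ a) ∧ not (col a u))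

switches : ∀ {n m} → Colouring n → Fin n → (Fin m → Fin n) → ℕ
switches col a f = count (λ x → not (⌊ Data.Bool._≟_ (col a (f x)) (col a (f (next x))) ⌋))

-- Write A x, B x for the colours of the edges a(x) and b(x + 2k − 2) (indices on C). If A x and B x
-- were both red, the arc x, …, x + 2k − 2 of C closed by b, a would be a red C_{2k+1}; if A (x + 1)
-- and B x were both red, the arc x + 1, …, x + 2k − 2 closed by b, c, a would be one. Hence every
-- switch of A lies in {x : A x, B x blue} or in {x : A (x + 1), B x blue}. In each of these sets the
-- two colours are never both red, so (blue A-labels) + (blue B-labels) = |C| + (size of the set);
-- as a and b have fewer than j blue neighbours in H, each set has at most 2(j − 1) − (2j − 502) = 500
-- elements. The same argument with a and b exchanged bounds the switches of B.
module Submission where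

open import Defs
open import Data.Nat using (ℕ; _+_; _*_; _∸_; _<_; _≤_)
open import Data.Fin using (Fin)
open import Data.Bool using (true; false)
open import Data.Product using (_×_)
open import Relation.Binary.PropositionalEquality using (_≡_; _≢_)
open import Relation.Nullary using (¬_)

open import Data.Bool using (Bool; not; _∧_; _∨_; if_then_else_)
import Data.Bool as Bool
open import Data.Empty using (⊥; ⊥-elim)
open import Data.Fin using (toℕ; punchIn; punchOut)
import Data.Fin as Fin
import Data.Fin.Properties as Finₚ
open import Data.Nat using (zero; suc; z≤n; s≤s)
open import Data.Nat.DivMod using (_%_; _/_; m%n<n; m<n⇒m%n≡m; n%n≡0; [m+n]%n≡m%n; %-distribˡ-+; m%n%n≡m%n; m≡m%n+[m/n]*n)
open import Data.Nat.GeneralisedArithmetic using (iterate)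
open import Data.Nat.Properties
open import Algebra.Properties.CommutativeSemigroup +-commutativeSemigroup using (interchange; x∙yz≈y∙xz)
open import Data.Product using (_,_; proj₁; proj₂; ∃-syntax)
open import Data.Sum using (_⊎_; inj₁; inj₂)
open import Function.Base using (id; _∘_)
open import Function.Definitions using (Injective)
open import Relation.Binary.Definitions using (tri<; tri≈; tri>)
open import Relation.Binary.PropositionalEquality using (refl; sym; trans; cong; cong₂; subst; subst₂; module ≡-Reasoning)
open import Relation.Nullary using (yes; no)
open import Relation.Nullary.Decidable using (⌊_⌋)

-- Counting

-- The summand of count, so that count P unfolds to ind (P zero) + count (P ∘ suc).
ind : Bool → ℕ
ind b = if b then 1 else 0

count-cong : ∀ {n} {P Q : Fin n → Bool} → (∀ i → P i ≡ Q i) → count P ≡ count Q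
count-cong {zero}  P≡Q = refl
count-cong {suc n} P≡Q = cong₂ _+_ (cong ind (P≡Q Fin.zero)) (count-cong (P≡Q ∘ Fin.suc))

count-mono : ∀ {n} {P Q : Fin n → Bool} → (∀ i → P i ≡ true → Q i ≡ true) → count P ≤ count Q
count-mono {zero}  P⇒Q = z≤n
count-mono {suc n} {P} {Q} P⇒Q =
  +-mono-≤ (ind-mono (P Fin.zero) (Q Fin.zero) (P⇒Q Fin.zero)) (count-mono (P⇒Q ∘ Fin.suc))
  where
  ind-mono : ∀ a b → (a ≡ true → b ≡ true) → ind a ≤ ind b
  ind-mono false b _   = z≤n
  ind-mono true  b a⇒b rewrite a⇒b refl = ≤-refl

count-all : ∀ {n} {P : Fin n → Bool} → (∀ i → P i ≡ true) → count P ≡ n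
count-all {zero}  all = refl
count-all {suc n} all rewrite all Fin.zero = cong suc (count-all (all ∘ Fin.suc))

count-∨-∧ : ∀ {n} (P Q : Fin n → Bool) →
  count P + count Q ≡ count (λ i → P i ∨ Q i) + count (λ i → P i ∧ Q i)
count-∨-∧ {zero}  P Q = refl
count-∨-∧ {suc n} P Q = begin
  (ind (P 0F) + count (P ∘ Fin.suc)) + (ind (Q 0F) + count (Q ∘ Fin.suc))
    ≡⟨ interchange (ind (P 0F)) _ _ _ ⟩
  (ind (P 0F) + ind (Q 0F)) + (count (P ∘ Fin.suc) + count (Q ∘ Fin.suc))
    ≡⟨ cong₂ _+_ (ind-∨-∧ (P 0F) (Q 0F)) (count-∨-∧ (P ∘ Fin.suc) (Q ∘ Fin.suc)) ⟩
  (ind (P 0F ∨ Q 0F) + ind (P 0F ∧ Q 0F))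
    + (count (λ i → P (Fin.suc i) ∨ Q (Fin.suc i)) + count (λ i → P (Fin.suc i) ∧ Q (Fin.suc i)))
    ≡⟨ interchange (ind (P 0F ∨ Q 0F)) _ _ _ ⟩
  count (λ i → P i ∨ Q i) + count (λ i → P i ∧ Q i) ∎
  where
  open ≡-Reasoning
  0F = Fin.zero
  ind-∨-∧ : ∀ a b → ind a + ind b ≡ ind (a ∨ b) + ind (a ∧ b)
  ind-∨-∧ false false = refl
  ind-∨-∧ false true  = refl
  ind-∨-∧ true  false = refl
  ind-∨-∧ true  true  = refl

count-∨-≤ : ∀ {n} (P Q : Fin n → Bool) → count (λ i → P i ∨ Q i) ≤ count P + count Q
count-∨-≤ P Q = ≤-trans (m≤m+n _ _) (≤-reflexive (sym (count-∨-∧ P Q)))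

count-∧-covering : ∀ {n} {P Q : Fin n → Bool} → (∀ i → P i ∨ Q i ≡ true) →
  count (λ i → P i ∧ Q i) + n ≡ count P + count Q
count-∧-covering {n} {P} {Q} covering = begin
  count (λ i → P i ∧ Q i) + n                          ≡⟨ +-comm _ n ⟩
  n + count (λ i → P i ∧ Q i)                          ≡⟨ cong (_+ count (λ i → P i ∧ Q i)) (count-all covering) ⟨
  count (λ i → P i ∨ Q i) + count (λ i → P i ∧ Q i)    ≡⟨ count-∨-∧ P Q ⟨
  count P + count Q                                    ∎
  where open ≡-Reasoning

count-punchIn : ∀ {n} (P : Fin (suc n) → Bool) w → count P ≡ ind (P w) + count (P ∘ punchIn w)
count-punchIn P Fin.zero = refl
count-punchIn {suc n} P (Fin.suc w) = begin
  ind (P Fin.zero) + count (P ∘ Fin.suc)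
    ≡⟨ cong (ind (P Fin.zero) +_) (count-punchIn (P ∘ Fin.suc) w) ⟩
  ind (P Fin.zero) + (ind (P (Fin.suc w)) + count (P ∘ Fin.suc ∘ punchIn w))
    ≡⟨ x∙yz≈y∙xz (ind (P Fin.zero)) (ind (P (Fin.suc w))) _ ⟩
  ind (P (Fin.suc w)) + count (P ∘ punchIn (Fin.suc w)) ∎
  where open ≡-Reasoning

-- Removing g zero from the codomain turns g ∘ suc into an injection into one fewer point.
count-∘-injective : ∀ {m n} (P : Fin n → Bool) {g : Fin m → Fin n} → Injective _≡_ _≡_ g →
  count (P ∘ g) ≤ count P
count-∘-injective {zero}          P g-inj = z≤n
count-∘-injective {suc m} {zero}  P {g} g-inj with () ← g Fin.zero
count-∘-injective {suc m} {suc n} P {g} g-inj = begin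
  ind (P w) + count (P ∘ g ∘ Fin.suc)      ≡⟨ cong (ind (P w) +_) (count-cong (λ i → cong P (sym (Finₚ.punchIn-punchOut (w≢ i))))) ⟩
  ind (P w) + count (P ∘ punchIn w ∘ g′)   ≤⟨ +-monoʳ-≤ (ind (P w)) (count-∘-injective (P ∘ punchIn w) g′-inj) ⟩
  ind (P w) + count (P ∘ punchIn w)        ≡⟨ count-punchIn P w ⟨
  count P                                  ∎
  where
  open ≤-Reasoning
  w = g Fin.zero
  w≢ : ∀ i → w ≢ g (Fin.suc i)
  w≢ i = Finₚ.0≢1+n ∘ g-inj
  g′ : Fin m → Fin n
  g′ i = punchOut (w≢ i)
  g′-inj : Injective _≡_ _≡_ g′
  g′-inj e = Finₚ.suc-injective (g-inj (Finₚ.punchOut-injective (w≢ _) (w≢ _) e))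

-- Cyclic shifts

toℕ-next : ∀ {m} (x : Fin (suc m)) → toℕ (next x) ≡ suc (toℕ x) % suc m
toℕ-next {m} x = Finₚ.toℕ-fromℕ< (m%n<n (suc (toℕ x)) (suc m))

rot : ∀ {m} → ℕ → Fin m → Fin m
rot t x = iterate next x t

rot-suc : ∀ {m} t (x : Fin m) → rot (suc t) x ≡ next (rot t x)
rot-suc zero    x = refl
rot-suc (suc t) x = rot-suc t (next x)

rot-+ : ∀ {m} t s (x : Fin m) → rot (t + s) x ≡ rot s (rot t x)
rot-+ zero    s x = refl
rot-+ (suc t) s x = rot-+ t s (next x)

[m%n+o]%n≡[m+o]%n : ∀ m o n → (m % suc n + o) % suc n ≡ (m + o) % suc n
[m%n+o]%n≡[m+o]%n m o n = begin
  (m % N + o) % N          ≡⟨ %-distribˡ-+ (m % N) o N ⟩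
  (m % N % N + o % N) % N  ≡⟨ cong (λ r → (r + o % N) % N) (m%n%n≡m%n m N) ⟩
  (m % N + o % N) % N      ≡⟨ %-distribˡ-+ m o N ⟨
  (m + o) % N              ∎
  where
  open ≡-Reasoning
  N = suc n

toℕ-rot : ∀ {m} t (x : Fin (suc m)) → toℕ (rot t x) ≡ (toℕ x + t) % suc m
toℕ-rot {m} zero    x = sym (trans (cong (_% suc m) (+-identityʳ (toℕ x))) (m<n⇒m%n≡m (Finₚ.toℕ<n x)))
toℕ-rot {m} (suc t) x = begin
  toℕ (rot t (next x))                 ≡⟨ toℕ-rot t (next x) ⟩
  (toℕ (next x) + t) % suc m           ≡⟨ cong (λ r → (r + t) % suc m) (toℕ-next x) ⟩
  (suc (toℕ x) % suc m + t) % suc m    ≡⟨ [m%n+o]%n≡[m+o]%n (suc (toℕ x)) t m ⟩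
  (suc (toℕ x) + t) % suc m            ≡⟨ cong (_% suc m) (+-suc (toℕ x) t) ⟨
  (toℕ x + suc t) % suc m              ∎
  where open ≡-Reasoning

rot-period : ∀ {m} (x : Fin m) → rot m x ≡ x
rot-period {suc m} x = Finₚ.toℕ-injective (begin
  toℕ (rot (suc m) x)          ≡⟨ toℕ-rot (suc m) x ⟩
  (toℕ x + suc m) % suc m      ≡⟨ [m+n]%n≡m%n (toℕ x) (suc m) ⟩
  toℕ x % suc m                ≡⟨ m<n⇒m%n≡m (Finₚ.toℕ<n x) ⟩
  toℕ x                        ∎)
  where open ≡-Reasoning

next-injective : ∀ {m} → Injective _≡_ _≡_ (next {m})
next-injective {suc m} {x} {y} e = begin
  x                  ≡⟨ rot-period x ⟨
  rot m (next x)     ≡⟨ cong (rot m) e ⟩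
  rot m (next y)     ≡⟨ rot-period y ⟩
  y                  ∎
  where open ≡-Reasoning

rot-injective : ∀ {m} t → Injective _≡_ _≡_ (rot {m} t)
rot-injective zero    e = e
rot-injective (suc t) e = next-injective (rot-injective t e)

-- y + s ≡ y (mod m) forces s to be a multiple q * m of m, and q < 1 since s < m.
rot-aperiodic : ∀ {m} s (y : Fin m) → 0 < s → s < m → rot s y ≢ y
rot-aperiodic {suc m} s y 0<s s<M e = <⇒≢ 0<s (sym (begin
  s           ≡⟨ s≡q*M ⟩
  q * suc m   ≡⟨ cong (_* suc m) (n<1⇒n≡0 q<1) ⟩
  0           ∎))
  where
  open ≡-Reasoning
  q = (toℕ y + s) / suc m
  s≡q*M : s ≡ q * suc m
  s≡q*M = +-cancelˡ-≡ (toℕ y) s (q * suc m) (begin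
    toℕ y + s                           ≡⟨ m≡m%n+[m/n]*n (toℕ y + s) (suc m) ⟩
    (toℕ y + s) % suc m + q * suc m     ≡⟨ cong (_+ q * suc m) (trans (sym (toℕ-rot s y)) (cong toℕ e)) ⟩
    toℕ y + q * suc m                   ∎)
  q<1 : q < 1
  q<1 = *-cancelʳ-< (suc m) q 1 (subst₂ _<_ s≡q*M (sym (*-identityˡ (suc m))) s<M)

rot-distinct : ∀ {m} {t t'} (x : Fin m) → t < t' → t' < m → rot t x ≢ rot t' x
rot-distinct {m} {t} {t'} x t<t' t'<m e =
  rot-aperiodic (t' ∸ t) (rot t x) (m<n⇒0<n∸m t<t') (≤-<-trans (m∸n≤m t' t) t'<m) (sym (begin
    rot t x                    ≡⟨ e ⟩
    rot t' x                   ≡⟨ cong (λ r → rot r x) (m+[n∸m]≡n (<⇒≤ t<t')) ⟨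
    rot (t + (t' ∸ t)) x       ≡⟨ rot-+ t (t' ∸ t) x ⟩
    rot (t' ∸ t) (rot t x)     ∎))
  where open ≡-Reasoning

-- Building cycles from closed walks

cycle-from-closedWalk : ∀ {n} {col : Colouring n} {c : Colour} ℓ (w : ℕ → Fin n) →
  (∀ t → t ≤ ℓ → col (w t) (w (suc t)) ≡ c) → w (suc ℓ) ≡ w 0 →
  (∀ {t t'} → t < t' → t' ≤ ℓ → w t ≢ w t') → HasMonoCycle col c (suc ℓ)
cycle-from-closedWalk {col = col} ℓ w edge closed distinct =
  w ∘ toℕ , injective , λ i → trans (cong (col (w (toℕ i))) (w-next i)) (edge (toℕ i) (Finₚ.toℕ≤pred[n] i))
  where
  injective : Injective _≡_ _≡_ (w ∘ toℕ)
  injective {i} {i'} e with <-cmp (toℕ i) (toℕ i')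
  ... | tri< lt _ _ = ⊥-elim (distinct lt (Finₚ.toℕ≤pred[n] i') e)
  ... | tri≈ _ eq _ = Finₚ.toℕ-injective eq
  ... | tri> _ _ gt = ⊥-elim (distinct gt (Finₚ.toℕ≤pred[n] i) (sym e))
  w-next : ∀ i → w (toℕ (next i)) ≡ w (suc (toℕ i))
  w-next i rewrite toℕ-next i with m≤n⇒m<n∨m≡n (Finₚ.toℕ≤pred[n] i)
  ... | inj₁ lt = cong w (m<n⇒m%n≡m (s≤s lt))
  ... | inj₂ eq rewrite eq = trans (cong w (n%n≡0 (suc ℓ))) (sym closed)

splice : ∀ {A : Set} → ℕ → (ℕ → A) → (ℕ → A) → ℕ → A
splice d p q t with t ≤? d
... | yes _ = p t
... | no  _ = q (t ∸ suc d)

module _ {A : Set} (d : ℕ) (p q : ℕ → A) where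

  splice-≤ : ∀ {t} → t ≤ d → splice d p q t ≡ p t
  splice-≤ {t} t≤d with t ≤? d
  ... | yes _   = refl
  ... | no  t≰d = ⊥-elim (t≰d t≤d)

  splice-> : ∀ u → splice d p q (suc (d + u)) ≡ q u
  splice-> u with suc (d + u) ≤? d
  ... | yes d+u<d = ⊥-elim (m+n≮m d u d+u<d)
  ... | no  _     = cong q (m+n∸m≡n d u)

≤-or-beyond : ∀ d t → t ≤ d ⊎ ∃[ u ] t ≡ suc (d + u)
≤-or-beyond d t with t ≤? d
... | yes t≤d = inj₁ t≤d
... | no  t≰d = inj₂ (t ∸ suc d , sym (m+[n∸m]≡n (≰⇒> t≰d)))

module _ {n m} {col : Colouring n} {c : Colour} {f : Fin m → Fin n} (cyc : MonoCycle col c m f) where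

  -- The new cycle runs f x, f (x + 1), …, f (x + d), path 0, …, path (e − 1).
  cycle-via-arc : ∀ (x : Fin m) d e (path : ℕ → Fin n) → d < m →
    col (f (rot d x)) (path 0) ≡ c →
    (∀ u → u < e → col (path u) (path (suc u)) ≡ c) → path e ≡ f x →
    (∀ u z → u < e → path u ≢ f z) → (∀ {u u'} → u < u' → u' < e → path u ≢ path u') →
    HasMonoCycle col c (suc (d + e))
  cycle-via-arc x d e path d<m arc→path path-edge path-end path∉f path-distinct =
    cycle-from-closedWalk {col = col} (d + e) walk edge closed distinct
    where
    arc walk : ℕ → Fin n
    arc t = f (rot t x)
    walk = splice d arc path
    walk-arc : ∀ {t} → t ≤ d → walk t ≡ arc t
    walk-arc = splice-≤ d arc path
    walk-path : ∀ u → walk (suc (d + u)) ≡ path u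
    walk-path = splice-> d arc path
    edge : ∀ t → t ≤ d + e → col (walk t) (walk (suc t)) ≡ c
    edge t t≤ with ≤-or-beyond d t
    edge t t≤ | inj₁ t≤d with m≤n⇒m<n∨m≡n t≤d
    ... | inj₁ t<d rewrite walk-arc t≤d | walk-arc t<d | rot-suc t x = proj₂ cyc (rot t x)
    ... | inj₂ refl rewrite walk-arc t≤d =
      trans (cong (col (arc d)) (trans (cong (walk ∘ suc) (sym (+-identityʳ d))) (walk-path 0))) arc→path
    edge _ t≤ | inj₂ (u , refl) =
      trans (cong₂ col (walk-path u) (trans (cong (walk ∘ suc) (sym (+-suc d u))) (walk-path (suc u))))
            (path-edge u (+-cancelˡ-< d u e t≤))
    closed : walk (suc (d + e)) ≡ walk 0
    closed = trans (walk-path e) (trans path-end (sym (walk-arc z≤n)))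
    distinct : ∀ {t t'} → t < t' → t' ≤ d + e → walk t ≢ walk t'
    distinct {t} {t'} t<t' t'≤ with ≤-or-beyond d t | ≤-or-beyond d t'
    ... | inj₁ t≤d | inj₁ t'≤d = λ w≡ → rot-distinct x t<t' (≤-<-trans t'≤d d<m)
      (proj₁ cyc (trans (sym (walk-arc t≤d)) (trans w≡ (walk-arc t'≤d))))
    ... | inj₁ t≤d | inj₂ (u' , refl) = λ w≡ → path∉f u' (rot t x) (+-cancelˡ-< d u' e t'≤)
      (trans (sym (walk-path u')) (trans (sym w≡) (walk-arc t≤d)))
    ... | inj₂ (u , refl) | inj₁ t'≤d = ⊥-elim (m+n≮m d u (≤-trans (<⇒≤ t<t') t'≤d))
    ... | inj₂ (u , refl) | inj₂ (u' , refl) = λ w≡ → path-distinct (+-cancelˡ-< d u u' (≤-pred t<t'))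
      (+-cancelˡ-< d u' e t'≤) (trans (sym (walk-path u)) (trans w≡ (walk-path u')))

module _ {n m} {col : Colouring n} (symm : SymmetricColouring col)
         {f : Fin m → Fin n} (cyc : MonoCycle col red m f)
         {p q : Fin n} (p≢q : p ≢ q) (p∉f : ∀ z → f z ≢ p) (q∉f : ∀ z → f z ≢ q)
         (x : Fin m) {d : ℕ} (d<m : d < m) (px : col p (f x) ≡ red) (qy : col q (f (rot d x)) ≡ red) where

  cycle-closed-by-edge : col p q ≡ red → HasMonoCycle col red (suc (d + 2))
  cycle-closed-by-edge pq =
    cycle-via-arc {col = col} cyc x d 2 path d<m (trans (symm _ _) qy) edge refl path∉f distinct
    where
    path : ℕ → Fin n
    path 0 = q
    path 1 = p
    path _ = f x
    edge : ∀ u → u < 2 → col (path u) (path (suc u)) ≡ red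
    edge 0 _ = trans (symm q p) pq
    edge 1 _ = px
    edge (suc (suc _)) (s≤s (s≤s ()))
    path∉f : ∀ u z → u < 2 → path u ≢ f z
    path∉f 0 z _ = q∉f z ∘ sym
    path∉f 1 z _ = p∉f z ∘ sym
    path∉f (suc (suc _)) _ (s≤s (s≤s ()))
    distinct : ∀ {u u'} → u < u' → u' < 2 → path u ≢ path u'
    distinct {0} {1} _ _ = p≢q ∘ sym
    distinct {_} {suc (suc _)} _ (s≤s (s≤s ()))
    distinct {suc _} {1} (s≤s ())

  cycle-closed-by-2-path : ∀ {c} → c ≢ p → c ≢ q → (∀ z → f z ≢ c) → col p c ≡ red → col q c ≡ red →
    HasMonoCycle col red (suc (d + 3))
  cycle-closed-by-2-path {c} c≢p c≢q c∉f pc qc =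
    cycle-via-arc {col = col} cyc x d 3 path d<m (trans (symm _ _) qy) edge refl path∉f distinct
    where
    path : ℕ → Fin n
    path 0 = q
    path 1 = c
    path 2 = p
    path _ = f x
    edge : ∀ u → u < 3 → col (path u) (path (suc u)) ≡ red
    edge 0 _ = qc
    edge 1 _ = trans (symm c p) pc
    edge 2 _ = px
    edge (suc (suc (suc _))) (s≤s (s≤s (s≤s ())))
    path∉f : ∀ u z → u < 3 → path u ≢ f z
    path∉f 0 z _ = q∉f z ∘ sym
    path∉f 1 z _ = c∉f z ∘ sym
    path∉f 2 z _ = p∉f z ∘ sym
    path∉f (suc (suc (suc _))) _ (s≤s (s≤s (s≤s ())))
    distinct : ∀ {u u'} → u < u' → u' < 3 → path u ≢ path u'
    distinct {0} {1} _ _ = c≢q ∘ sym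
    distinct {0} {2} _ _ = p≢q ∘ sym
    distinct {1} {2} _ _ = c≢p
    distinct {_} {suc (suc (suc _))} _ (s≤s (s≤s (s≤s ())))
    distinct {suc _} {1} (s≤s ())
    distinct {suc (suc _)} {2} (s≤s (s≤s ()))

-- Counting switches

blueOn≤blueDegInH : ∀ {n m} {col : Colouring n} v p (g : Fin m → Fin n) → Injective _≡_ _≡_ g →
  (∀ z → inNB col v (g z) ≡ true) → (∀ z → g z ≢ p) →
  count (λ z → not (col p (g z))) ≤ blueDegInH col v p
blueOn≤blueDegInH {col = col} v p g g-inj g∈H g≢p =
  ≤-trans (count-mono blue⇒blueInH) (count-∘-injective _ g-inj)
  where
  blue⇒blueInH : ∀ z → not (col p (g z)) ≡ true → inNB col v (g z) ∧ (g z ≠ᵇ p) ∧ not (col p (g z)) ≡ true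
  blue⇒blueInH z blue rewrite g∈H z with g z Fin.≟ p
  ... | yes g≡p = ⊥-elim (g≢p z g≡p)
  ... | no  _   = blue

not-both : ∀ a b → (a ≡ true → b ≡ true → ⊥) → not a ∨ not b ≡ true
not-both false _     _ = refl
not-both true  false _ = refl
not-both true  true  ¬both with () ← ¬both refl refl

switch⇒blue : ∀ a a' b → not a ∨ not b ≡ true → not a' ∨ not b ≡ true →
  not ⌊ a Bool.≟ a' ⌋ ≡ true → (not a ∧ not b) ∨ (not a' ∧ not b) ≡ true
switch⇒blue true  false false _ _ _ = refl
switch⇒blue false true  false _ _ _ = refl
switch⇒blue true  true  _     _ _ ()
switch⇒blue false false _     _ _ ()
switch⇒blue true  false true  () _ _
switch⇒blue false true  true  _ () _

overlap-bound : ∀ {X m a b j} s → X + m ≡ a + b → a < j → b < j → m + suc (suc s) ≡ 2 * j → X ≤ s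
overlap-bound {X} {m} {a} {b} {j} s X+m≡a+b a<j b<j m≡ = +-cancelˡ-≤ (suc (suc m)) X s (begin
  suc (suc (m + X))    ≡⟨ cong (suc ∘ suc) (trans (+-comm m X) X+m≡a+b) ⟩
  suc (suc (a + b))    ≡⟨ cong suc (+-suc a b) ⟨
  suc a + suc b        ≤⟨ +-mono-≤ a<j b<j ⟩
  j + j                ≡⟨ cong (j +_) (+-identityʳ j) ⟨
  2 * j                ≡⟨ m≡ ⟨
  m + suc (suc s)      ≡⟨ +-suc m (suc s) ⟩
  suc (m + suc s)      ≡⟨ cong suc (+-suc m s) ⟩
  suc (suc (m + s))    ∎)
  where open ≤-Reasoning

module _ {n m} {col : Colouring n} (symm : SymmetricColouring col) (v : Fin n)
         {f : Fin m → Fin n} (cyc : MonoCycle col red m f) (f∈H : ∀ z → inNB col v (f z) ≡ true)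
         {j d : ℕ} (no-cycle : ¬ HasMonoCycle col red (suc (d + 3))) (d<m : suc d < m) (m≡ : m + 502 ≡ 2 * j) where

  switches≤1000 : ∀ {p q c} → p ≢ q → c ≢ p → c ≢ q → col p q ≡ red → col p c ≡ red → col q c ≡ red →
    (∀ z → f z ≢ p) → (∀ z → f z ≢ q) → (∀ z → f z ≢ c) →
    blueDegInH col v p < j → blueDegInH col v q < j → switches col p f ≤ 1000
  switches≤1000 {p} {q} {c} p≢q c≢p c≢q pq pc qc p∉f q∉f c∉f deg-p deg-q = begin
    switches col p f
      ≤⟨ count-mono (λ x → switch⇒blue (A x) (A (next x)) (B x) (cover₁ x) (cover₂ x)) ⟩
    count (λ x → bothBlue id x ∨ bothBlue next x)
      ≤⟨ count-∨-≤ (bothBlue id) (bothBlue next) ⟩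
    count (bothBlue id) + count (bothBlue next)
      ≤⟨ +-mono-≤ (bothBlue≤500 id (λ e → e) cover₁) (bothBlue≤500 next next-injective cover₂) ⟩
    500 + 500 ∎
    where
    open ≤-Reasoning
    A B : Fin m → Bool
    A x = col p (f x)
    B x = col q (f (rot (suc d) x))
    bothBlue : (Fin m → Fin m) → Fin m → Bool
    bothBlue g x = not (A (g x)) ∧ not (B x)
    cover₁ : ∀ x → not (A x) ∨ not (B x) ≡ true
    cover₁ x = not-both _ _ λ px qy → no-cycle (subst (HasMonoCycle col red) (cong suc (sym (+-suc d 2)))
      (cycle-closed-by-edge symm cyc p≢q p∉f q∉f x d<m px qy pq))
    cover₂ : ∀ x → not (A (next x)) ∨ not (B x) ≡ true
    cover₂ x = not-both _ _ λ px qy → no-cycle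
      (cycle-closed-by-2-path symm cyc p≢q p∉f q∉f (next x) (<-trans (n<1+n d) d<m) px qy c≢p c≢q c∉f pc qc)
    bothBlue≤500 : (g : Fin m → Fin m) → Injective _≡_ _≡_ g → (∀ x → not (A (g x)) ∨ not (B x) ≡ true) →
      count (bothBlue g) ≤ 500
    bothBlue≤500 g g-inj cover = overlap-bound 500 (count-∧-covering cover)
      (≤-<-trans (blueOn≤blueDegInH v p (f ∘ g) (λ e → g-inj (proj₁ cyc e)) (f∈H ∘ g) (p∉f ∘ g)) deg-p)
      (≤-<-trans (blueOn≤blueDegInH v q (f ∘ rot (suc d)) (λ e → rot-injective (suc d) (proj₁ cyc e))
                                     (f∈H ∘ rot (suc d)) (q∉f ∘ rot (suc d))) deg-q)
      m≡

lemma23 : (j k : ℕ) → k + 250 < j → 2 * j < 3 * k → 212299 ≤ j → 141534 ≤ k →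
    (col : Colouring (4 * j + 1)) → SymmetricColouring col →
    ¬ HasMonoCycle col red (2 * k + 1) →
    ¬ HasMonoWheel col blue (2 * j) →
    (v : Fin (4 * j + 1)) → ((w : Fin (4 * j + 1)) → blueDeg col w ≤ blueDeg col v) →
    (a b : Fin (4 * j + 1)) → inNB col v a ≡ true → inNB col v b ≡ true →
    a ≢ b → col a b ≡ red →
    blueDegInH col v a < j → blueDegInH col v b < j →
    (f : Fin (2 * j ∸ 502) → Fin (4 * j + 1)) → MonoCycle col red (2 * j ∸ 502) f →
    ((i : Fin (2 * j ∸ 502)) → inNB col v (f i) ≡ true × f i ≢ a × f i ≢ b) →
    (c : Fin (4 * j + 1)) → inNB col v c ≡ true → ((i : Fin (2 * j ∸ 502)) → f i ≢ c) →
    c ≢ a → c ≢ b → col a c ≡ red → col b c ≡ red →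
    switches col a f ≤ 1000 × switches col b f ≤ 1000
lemma23 j k k+250<j _ _ 141534≤k col symm no-red-cycle _ v _ a b _ _ a≢b ab deg-a deg-b f cyc f∈H c _ c∉f c≢a c≢b ac bc =
    switches≤1000 symm v cyc (proj₁ ∘ f∈H) no-cycle d<m m≡ a≢b c≢a c≢b ab ac bc a∉f b∉f c∉f deg-a deg-b
  , switches≤1000 symm v cyc (proj₁ ∘ f∈H) no-cycle d<m m≡ (a≢b ∘ sym) c≢b c≢a (trans (symm b a) ab) bc ac
      b∉f a∉f c∉f deg-b deg-a
  where
  d = 2 * k ∸ 3
  3≤2k : 3 ≤ 2 * k
  3≤2k = ≤-trans (m≤m+n 3 141531) (≤-trans 141534≤k (m≤m+n k (k + 0)))
  2k+502≤2j : 2 * k + 502 ≤ 2 * j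
  2k+502≤2j = subst (_≤ 2 * j) (trans (cong (2 *_) (sym (+-suc k 250))) (*-distribˡ-+ 2 k 251)) (*-monoʳ-≤ 2 k+250<j)
  no-cycle : ¬ HasMonoCycle col red (suc (d + 3))
  no-cycle = no-red-cycle ∘ subst (HasMonoCycle col red) (trans (cong suc (m∸n+n≡m 3≤2k)) (+-comm 1 (2 * k)))
  d<m : suc d < 2 * j ∸ 502
  d<m = ≤-trans (n≤1+n _) (≤-trans (≤-reflexive (m+[n∸m]≡n 3≤2k)) (m+n≤o⇒m≤o∸n (2 * k) 2k+502≤2j))
  m≡ : 2 * j ∸ 502 + 502 ≡ 2 * j
  m≡ = m∸n+n≡m (≤-trans (m≤n+m 502 (2 * k)) 2k+502≤2j)
  a∉f : ∀ z → f z ≢ a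
  a∉f = proj₁ ∘ proj₂ ∘ f∈H
  b∉f : ∀ z → f z ≢ b
  b∉f = proj₂ ∘ proj₂ ∘ f∈H
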